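{- Let $G$ be a simple 2-connected graph of order $n\ge 10$. If $G$ is $\{K_{1,3}, Z_1\}$-free, then either $G$ is the cycle $C_n$ or $G$ is chorded pancyclic.
   Context: For graphs $H_1,\dots,H_r$, $G$ is $\{H_1,\dots,H_r\}$-free if $G$ contains no induced subgraph isomorphic to any $H_i$. $K_{1,3}$ is the claw. $Z_1$ is the graph obtained from a triangle by adding one new vertex adjacent to exactly one vertex of the triangle. A chorded cycle is a cycle $C$ such that $G$ has an edge joining two vertices nonconsecutive on $C$. A graph $G$ of order $n$ is chorded pancyclic if it contains a chorded cycle of every length $m$ with $4\le m\le n$. -}

module Defs where

open import Data.Nat using (ℕ; zero; suc; _≤_)
open import Data.Fin using (Fin; toℕ) renaming (zero to f0; suc to fs)
open import Data.Bool using (Bool; true; false)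
open import Data.Product using (Σ; _×_; _,_; ∃)
open import Data.Sum using (_⊎_)
open import Data.Unit using (⊤)
open import Relation.Binary.PropositionalEquality using (_≡_; _≢_)
open import Relation.Nullary using (¬_)
open import Function.Definitions using (Injective)
open import Function.Bundles using (_⇔_)

record Graph (n : ℕ) : Set where
  field
    adj    : Fin n → Fin n → Bool
    sym    : ∀ u v → adj u v ≡ adj v u
    irrefl : ∀ v → adj v v ≡ false

open Graph public

Edge : ∀ {n} → Graph n → Fin n → Fin n → Set
Edge G u v = adj G u v ≡ true

InducedCopy : ∀ {k n} → Graph k → Graph n → Set
InducedCopy {k} {n} H G =
  Σ (Fin k → Fin n) λ f → Injective _≡_ _≡_ f × (∀ i j → adj H i j ≡ adj G (f i) (f j))

Free : ∀ {k n} → Graph k → Graph n → Set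
Free H G = ¬ InducedCopy H G

clawAdj : Fin 4 → Fin 4 → Bool
clawAdj f0 (fs _) = true
clawAdj (fs _) f0 = true
clawAdj _ _ = false

claw : Graph 4
claw = record { adj = clawAdj ; sym = s ; irrefl = r }
  where
  s : ∀ u v → clawAdj u v ≡ clawAdj v u
  s f0 f0 = _≡_.refl
  s f0 (fs v) = _≡_.refl
  s (fs u) f0 = _≡_.refl
  s (fs u) (fs v) = _≡_.refl
  r : ∀ v → clawAdj v v ≡ false
  r f0 = _≡_.refl
  r (fs v) = _≡_.refl

-- Z_1: triangle on 0, 1, 2 plus vertex 3 adjacent only to 0.
z1Adj : Fin 4 → Fin 4 → Bool
z1Adj f0 (fs f0) = true
z1Adj f0 (fs (fs f0)) = true
z1Adj f0 (fs (fs (fs f0))) = true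
z1Adj (fs f0) f0 = true
z1Adj (fs f0) (fs (fs f0)) = true
z1Adj (fs (fs f0)) f0 = true
z1Adj (fs (fs f0)) (fs f0) = true
z1Adj (fs (fs (fs f0))) f0 = true
z1Adj _ _ = false

Z₁ : Graph 4
Z₁ = record { adj = z1Adj ; sym = s ; irrefl = r }
  where
  s : ∀ u v → z1Adj u v ≡ z1Adj v u
  s f0 f0 = _≡_.refl
  s f0 (fs f0) = _≡_.refl
  s f0 (fs (fs f0)) = _≡_.refl
  s f0 (fs (fs (fs f0))) = _≡_.refl
  s (fs f0) f0 = _≡_.refl
  s (fs f0) (fs f0) = _≡_.refl
  s (fs f0) (fs (fs f0)) = _≡_.refl
  s (fs f0) (fs (fs (fs f0))) = _≡_.refl
  s (fs (fs f0)) f0 = _≡_.refl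
  s (fs (fs f0)) (fs f0) = _≡_.refl
  s (fs (fs f0)) (fs (fs f0)) = _≡_.refl
  s (fs (fs f0)) (fs (fs (fs f0))) = _≡_.refl
  s (fs (fs (fs f0))) f0 = _≡_.refl
  s (fs (fs (fs f0))) (fs f0) = _≡_.refl
  s (fs (fs (fs f0))) (fs (fs f0)) = _≡_.refl
  s (fs (fs (fs f0))) (fs (fs (fs f0))) = _≡_.refl
  r : ∀ v → z1Adj v v ≡ false
  r f0 = _≡_.refl
  r (fs f0) = _≡_.refl
  r (fs (fs f0)) = _≡_.refl
  r (fs (fs (fs f0))) = _≡_.refl

data ReachIn {n} (G : Graph n) (P : Fin n → Set) : Fin n → Fin n → Set where
  here : ∀ {u} → P u → ReachIn G P u u
  step : ∀ {u w v} → P u → Edge G u w → ReachIn G P w v → ReachIn G P u v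

Connected : ∀ {n} → Graph n → Set
Connected G = ∀ u v → ReachIn G (λ _ → ⊤) u v

TwoConnected : ∀ {n} → Graph n → Set
TwoConnected {n} G =
  3 ≤ n × Connected G ×
  (∀ x u v → u ≢ x → v ≢ x → ReachIn G (λ y → y ≢ x) u v)

CycSucc : (m : ℕ) → Fin m → Fin m → Set
CycSucc m i j = toℕ j ≡ suc (toℕ i) ⊎ (suc (toℕ i) ≡ m × toℕ j ≡ 0)

Consecutive : (m : ℕ) → Fin m → Fin m → Set
Consecutive m i j = CycSucc m i j ⊎ CycSucc m j i

IsCycle : ∀ {n} → Graph n → (m : ℕ) → (Fin m → Fin n) → Set
IsCycle G m c = 3 ≤ m × Injective _≡_ _≡_ c × (∀ i j → CycSucc m i j → Edge G (c i) (c j))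

HasChord : ∀ {n} → Graph n → (m : ℕ) → (Fin m → Fin n) → Set
HasChord G m c = Σ (Fin m) λ i → Σ (Fin m) λ j →
  i ≢ j × ¬ Consecutive m i j × Edge G (c i) (c j)

ChordedCycleOfLength : ∀ {n} → Graph n → ℕ → Set
ChordedCycleOfLength {n} G m = Σ (Fin m → Fin n) λ c → IsCycle G m c × HasChord G m c

ChordedPancyclic : ∀ {n} → Graph n → Set
ChordedPancyclic {n} G = ∀ m → 4 ≤ m → m ≤ n → ChordedCycleOfLength G m

-- G is (isomorphic to) the cycle C_n: a vertex bijection σ (injective self-map
-- of Fin n) such that σ i ~ σ j in G iff i, j are consecutive on C_n.
IsCycleGraph : ∀ {n} → Graph n → Set
IsCycleGraph {n} G = Σ (Fin n → Fin n) λ σ →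
  Injective _≡_ _≡_ σ × (∀ i j → Consecutive n i j ⇔ Edge G (σ i) (σ j))

-- If some vertex lies on a triangle, an induced Z₁ is the only way a neighbour
-- could fail to lie on one too, so in a connected graph either there is no
-- triangle or every vertex is on a triangle. In the latter case claw- and
-- Z₁-freeness keep every vertex within distance two of any given vertex v and
-- allow only one vertex at distance two, so each vertex has at most one
-- non-neighbour. A triangle plus a fourth vertex then contains a 4-cycle with a
-- chord, a cycle of length L < n grows by inserting an outside vertex between
-- two consecutive vertices it sees among the first four, and on a cycle of
-- length at least 5 the first vertex sees the third or the fourth: a chord.
-- Without triangles, claw-freeness bounds every degree by two and
-- 2-connectivity excludes degree one, so a walk that never turns back closes
-- into a cycle, which is all of G by connectivity.

module Submission where

open import Defs hiding (sym)
open import Data.Bool using (true; false)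
open import Data.Bool.Properties using () renaming (_≟_ to _≟B_)
open import Data.Empty using (⊥; ⊥-elim)
open import Data.Fin using (Fin; toℕ; fromℕ<) renaming (zero to f0; suc to fs; _≟_ to _≟F_)
open import Data.Fin.Properties
  using (toℕ-injective; toℕ<n; toℕ-fromℕ<; any?; all?; ¬∀⟶∃¬; injective⇒≤)
open import Data.Nat using (ℕ; zero; suc; _≤_; _<_; _+_; z≤n; s≤s; pred) renaming (_≟_ to _≟ℕ_)
open import Data.Nat.Properties
  using ( <-cmp; ≤-refl; ≤-trans; <-trans; <-≤-trans; <-irrefl; <-asym; ≤-antisym; n≤1+n; n<1+n
        ; <⇒≤; <⇒≢; <⇒≱; ≤-pred; suc[m]≤n⇒m≤pred[n]; ≤∧≢⇒<; 1+n≰n )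
open import Data.Product using (Σ; _×_; _,_; proj₁; proj₂)
open import Data.Sum using (_⊎_; inj₁; inj₂; [_,_])
import Data.Sum as Sum
open import Function using (_∘_)
open import Function.Definitions using (Injective)
open import Function.Bundles using (mk⇔)
open import Relation.Binary using (tri<; tri≈; tri>)
open import Relation.Binary.PropositionalEquality using (_≡_; _≢_; refl; sym; trans; cong; subst; ≢-sym)
open import Relation.Nullary using (¬_; yes; no; Dec)
open import Relation.Nullary.Decidable using (_×-dec_)

pred-< : ∀ {p i k} → p < i → i < suc k → pred i < k
pred-< {i = suc _} _ (s≤s i<k) = i<k

pred-injective : ∀ {p i j} → p < i → p < j → pred i ≡ pred j → i ≡ j
pred-injective {i = suc _} {suc _} _ _ = cong suc

-- For i j : Fin m, CycSucc m i j unfolds to Successor m (toℕ i) (toℕ j).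
Successor : ℕ → ℕ → ℕ → Set
Successor m i j = j ≡ suc i ⊎ (suc i ≡ m × j ≡ 0)

successor-index : ∀ {L} i → i < L → Σ ℕ λ j → j < L × Successor L i j
successor-index {L} i i<L with suc i ≟ℕ L
... | yes 1+i≡L = 0 , ≤-trans (s≤s z≤n) i<L , inj₂ (1+i≡L , refl)
... | no  1+i≢L = suc i , ≤∧≢⇒< i<L 1+i≢L , inj₁ refl

predecessor-index : ∀ {L} i → i < L → Σ ℕ λ j → j < L × Successor L j i
predecessor-index {suc L} zero    _     = L , n<1+n L , inj₂ (refl , refl)
predecessor-index         (suc i) 1+i<L = i , <-trans (n<1+n i) 1+i<L , inj₁ refl

successor-asym : ∀ {L i j} → 3 ≤ L → Successor L i j → ¬ Successor L j i
successor-asym _                   (inj₁ refl)         (inj₁ ())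
successor-asym (s≤s (s≤s ()))      (inj₁ refl)         (inj₂ (refl , refl))
successor-asym (s≤s (s≤s ()))      (inj₂ (refl , refl)) (inj₁ refl)

non-consecutive-0-2 : ∀ {k} → ¬ Consecutive (4 + k) f0 (fs (fs f0))
non-consecutive-0-2 =
  λ { (inj₁ (inj₁ ())) ; (inj₁ (inj₂ (() , _))) ; (inj₂ (inj₁ ())) ; (inj₂ (inj₂ (() , _))) }

non-consecutive-0-3 : ∀ {k} → ¬ Consecutive (5 + k) f0 (fs (fs (fs f0)))
non-consecutive-0-3 =
  λ { (inj₁ (inj₁ ())) ; (inj₁ (inj₂ (() , _))) ; (inj₂ (inj₁ ())) ; (inj₂ (inj₂ (() , _))) }

two-vertices : ∀ {n} → 2 ≤ n → Σ (Fin n) λ v → Σ (Fin n) λ w → v ≢ w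
two-vertices {suc zero}    (s≤s ())
two-vertices {suc (suc _)} _ = f0 , fs f0 , λ ()

module Adjacency {n : ℕ} (G : Graph n) where

  infix 4 _~_ _≁_

  _~_ : Fin n → Fin n → Set
  _~_ = Edge G

  _≁_ : Fin n → Fin n → Set
  u ≁ v = adj G u v ≡ false

  ~-or-≁ : ∀ u v → u ~ v ⊎ u ≁ v
  ~-or-≁ u v with adj G u v
  ... | true  = inj₁ refl
  ... | false = inj₂ refl

  ~⇒¬≁ : ∀ {u v} → u ~ v → ¬ u ≁ v
  ~⇒¬≁ u~v u≁v with () ← trans (sym u~v) u≁v

  ~-sym : ∀ {u v} → u ~ v → v ~ u
  ~-sym {u} {v} = trans (Graph.sym G v u)

  ≁-sym : ∀ {u v} → u ≁ v → v ≁ u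
  ≁-sym {u} {v} = trans (Graph.sym G v u)

  ~⇒≢ : ∀ {u v} → u ~ v → u ≢ v
  ~⇒≢ {u} u~u refl = ~⇒¬≁ u~u (irrefl G u)

  ~-≁⇒≢ : ∀ {u v w} → u ~ v → u ≁ w → v ≢ w
  ~-≁⇒≢ u~v u≁v refl = ~⇒¬≁ u~v u≁v

  NonNeighbour : Fin n → Fin n → Set
  NonNeighbour v x = x ≢ v × v ≁ x

  InTriangle : Fin n → Set
  InTriangle v = Σ (Fin n) λ a → Σ (Fin n) λ b → v ~ a × v ~ b × a ~ b

  HasTriangle : Set
  HasTriangle = Σ (Fin n) InTriangle

  AtMostOneNonNeighbour : Set
  AtMostOneNonNeighbour = ∀ {v x y} → NonNeighbour v x → NonNeighbour v y → x ≡ y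

  TriangleFree : Set
  TriangleFree = ¬ HasTriangle

  triangle? : Dec HasTriangle
  triangle? = any? λ v → any? λ a → any? λ b → edge? v a ×-dec edge? v b ×-dec edge? a b
    where
    edge? : ∀ u v → Dec (u ~ v)
    edge? u v = adj G u v ≟B true

  MaxDegreeTwo : Set
  MaxDegreeTwo = ∀ {u x y z} → u ~ x → u ~ y → u ~ z → x ≢ y → z ≡ x ⊎ z ≡ y

  NoDegreeOne : Set
  NoDegreeOne = ∀ {u p} → u ~ p → Σ (Fin n) λ w → u ~ w × w ≢ p

  first-step : ∀ {P a b} → ReachIn G P a b → a ≢ b → Σ (Fin n) λ w → a ~ w × P w
  first-step (here _)                   a≢a = ⊥-elim (a≢a refl)
  first-step (step _ a~w (here pw))     _   = _ , a~w , pw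
  first-step (step _ a~w (step pw _ _)) _   = _ , a~w , pw

  induced-copy : (H : Graph 4) (a b c d : Fin n) →
    a ≢ b → a ≢ c → a ≢ d → b ≢ c → b ≢ d → c ≢ d →
    adj H f0 (fs f0) ≡ adj G a b → adj H f0 (fs (fs f0)) ≡ adj G a c →
    adj H f0 (fs (fs (fs f0))) ≡ adj G a d → adj H (fs f0) (fs (fs f0)) ≡ adj G b c →
    adj H (fs f0) (fs (fs (fs f0))) ≡ adj G b d →
    adj H (fs (fs f0)) (fs (fs (fs f0))) ≡ adj G c d → InducedCopy H G
  induced-copy H a b c d a≢b a≢c a≢d b≢c b≢d c≢d ab ac ad bc bd cd =
    f , (λ {i} {j} → injective i j) , adjacency
    where
    f : Fin 4 → Fin n
    f f0                = a
    f (fs f0)           = b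
    f (fs (fs f0))      = c
    f (fs (fs (fs f0))) = d

    distinct : ∀ i j → i ≢ j → f i ≢ f j
    distinct f0                  f0                  i≢j = ⊥-elim (i≢j refl)
    distinct f0                  (fs f0)             _   = a≢b
    distinct f0                  (fs (fs f0))        _   = a≢c
    distinct f0                  (fs (fs (fs f0)))   _   = a≢d
    distinct (fs f0)             f0                  _   = ≢-sym a≢b
    distinct (fs f0)             (fs f0)             i≢j = ⊥-elim (i≢j refl)
    distinct (fs f0)             (fs (fs f0))        _   = b≢c
    distinct (fs f0)             (fs (fs (fs f0)))   _   = b≢d
    distinct (fs (fs f0))        f0                  _   = ≢-sym a≢c
    distinct (fs (fs f0))        (fs f0)             _   = ≢-sym b≢c
    distinct (fs (fs f0))        (fs (fs f0))        i≢j = ⊥-elim (i≢j refl)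
    distinct (fs (fs f0))        (fs (fs (fs f0)))   _   = c≢d
    distinct (fs (fs (fs f0)))   f0                  _   = ≢-sym a≢d
    distinct (fs (fs (fs f0)))   (fs f0)             _   = ≢-sym b≢d
    distinct (fs (fs (fs f0)))   (fs (fs f0))        _   = ≢-sym c≢d
    distinct (fs (fs (fs f0)))   (fs (fs (fs f0)))   i≢j = ⊥-elim (i≢j refl)

    injective : ∀ i j → f i ≡ f j → i ≡ j
    injective i j fi≡fj with i ≟F j
    ... | yes i≡j = i≡j
    ... | no  i≢j = ⊥-elim (distinct i j i≢j fi≡fj)

    flip : ∀ i j → adj H i j ≡ adj G (f i) (f j) → adj H j i ≡ adj G (f j) (f i)
    flip i j e = trans (Graph.sym H j i) (trans e (Graph.sym G (f i) (f j)))

    diagonal : ∀ i → adj H i i ≡ adj G (f i) (f i)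
    diagonal i = trans (irrefl H i) (sym (irrefl G (f i)))

    adjacency : ∀ i j → adj H i j ≡ adj G (f i) (f j)
    adjacency f0                f0                = diagonal f0
    adjacency f0                (fs f0)           = ab
    adjacency f0                (fs (fs f0))      = ac
    adjacency f0                (fs (fs (fs f0))) = ad
    adjacency (fs f0)           f0                = flip f0 (fs f0) ab
    adjacency (fs f0)           (fs f0)           = diagonal (fs f0)
    adjacency (fs f0)           (fs (fs f0))      = bc
    adjacency (fs f0)           (fs (fs (fs f0))) = bd
    adjacency (fs (fs f0))      f0                = flip f0 (fs (fs f0)) ac
    adjacency (fs (fs f0))      (fs f0)           = flip (fs f0) (fs (fs f0)) bc
    adjacency (fs (fs f0))      (fs (fs f0))      = diagonal (fs (fs f0))
    adjacency (fs (fs f0))      (fs (fs (fs f0))) = cd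
    adjacency (fs (fs (fs f0))) f0                = flip f0 (fs (fs (fs f0))) ad
    adjacency (fs (fs (fs f0))) (fs f0)           = flip (fs f0) (fs (fs (fs f0))) bd
    adjacency (fs (fs (fs f0))) (fs (fs f0))      = flip (fs (fs f0)) (fs (fs (fs f0))) cd
    adjacency (fs (fs (fs f0))) (fs (fs (fs f0))) = diagonal (fs (fs (fs f0)))

module ClawZ₁Free {n : ℕ} (G : Graph n) (claw-free : Free claw G) (Z₁-free : Free Z₁ G) where

  open Adjacency G

  no-claw : ∀ {u x y z} → x ≢ y → x ≢ z → y ≢ z →
    u ~ x → u ~ y → u ~ z → x ≁ y → x ≁ z → y ≁ z → ⊥
  no-claw x≢y x≢z y≢z u~x u~y u~z x≁y x≁z y≁z =
    claw-free (induced-copy claw _ _ _ _ (~⇒≢ u~x) (~⇒≢ u~y) (~⇒≢ u~z) x≢y x≢z y≢z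
      (sym u~x) (sym u~y) (sym u~z) (sym x≁y) (sym x≁z) (sym y≁z))

  no-Z₁ : ∀ {a b c d} → a ~ b → a ~ c → b ~ c → a ~ d → b ≁ d → c ≁ d → ⊥
  no-Z₁ a~b a~c b~c a~d b≁d c≁d =
    Z₁-free (induced-copy Z₁ _ _ _ _ (~⇒≢ a~b) (~⇒≢ a~c) (~⇒≢ a~d) (~⇒≢ b~c)
      (~-≁⇒≢ (~-sym b~c) c≁d) (~-≁⇒≢ b~c b≁d)
      (sym a~b) (sym a~c) (sym a~d) (sym b~c) (sym b≁d) (sym c≁d))

  triangle-spreads : ∀ {u v} → InTriangle u → u ~ v → InTriangle v
  triangle-spreads {u} {v} (a , b , u~a , u~b , a~b) u~v with ~-or-≁ v a | ~-or-≁ v b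
  ... | inj₁ v~a | _        = u , a , ~-sym u~v , v~a , u~a
  ... | inj₂ _   | inj₁ v~b = u , b , ~-sym u~v , v~b , u~b
  ... | inj₂ v≁a | inj₂ v≁b = ⊥-elim (no-Z₁ u~a u~b a~b u~v (≁-sym v≁a) (≁-sym v≁b))

  triangle-reach : ∀ {P a b} → ReachIn G P a b → InTriangle a → InTriangle b
  triangle-reach (here _)        t = t
  triangle-reach (step _ e rest) t = triangle-reach rest (triangle-spreads t e)

  P₃-centre-neighbour : ∀ {c u x w} → c ~ u → c ~ x → u ≁ x → u ≢ x →
    c ~ w → w ≢ u → w ≢ x → w ~ u × w ~ x
  P₃-centre-neighbour {_} {u} {x} {w} c~u c~x u≁x u≢x c~w w≢u w≢x with ~-or-≁ w u | ~-or-≁ w x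
  ... | inj₁ w~u | inj₁ w~x = w~u , w~x
  ... | inj₁ w~u | inj₂ w≁x = ⊥-elim (no-Z₁ c~w c~u w~u c~x w≁x u≁x)
  ... | inj₂ w≁u | inj₁ w~x = ⊥-elim (no-Z₁ c~w c~x w~x c~u w≁u (≁-sym u≁x))
  ... | inj₂ w≁u | inj₂ w≁x =
    ⊥-elim (no-claw u≢x (≢-sym w≢u) (≢-sym w≢x) c~u c~x c~w u≁x (≁-sym w≁u) (≁-sym w≁x))

  third-neighbour : ∀ {c u s} → InTriangle c → u ≁ s → Σ (Fin n) λ w → c ~ w × w ≢ u × w ≢ s
  third-neighbour {c} {u} {s} (a , b , c~a , c~b , a~b) u≁s
    with a ≟F u | a ≟F s | b ≟F u | b ≟F s
  ... | no a≢u   | no a≢s   | _        | _        = a , c~a , a≢u , a≢s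
  ... | _        | _        | no b≢u   | no b≢s   = b , c~b , b≢u , b≢s
  ... | yes refl | _        | yes refl | _        = ⊥-elim (~⇒≢ a~b refl)
  ... | _        | yes refl | _        | yes refl = ⊥-elim (~⇒≢ a~b refl)
  ... | yes refl | _        | _        | yes refl = ⊥-elim (~⇒¬≁ a~b u≁s)
  ... | _        | yes refl | yes refl | _        = ⊥-elim (~⇒¬≁ (~-sym a~b) u≁s)

  SecondNeighbour : Fin n → Fin n → Set
  SecondNeighbour v x = NonNeighbour v x × Σ (Fin n) λ u → v ~ u × u ~ x

  second-neighbour-unique-via : ∀ {v u x y} → v ~ u → u ~ x → u ~ y →
    NonNeighbour v x → NonNeighbour v y → x ≡ y
  second-neighbour-unique-via {x = x} {y} v~u u~x u~y (x≢v , v≁x) (y≢v , v≁y) with x ≟F y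
  ... | yes x≡y = x≡y
  ... | no x≢y with ~-or-≁ x y
  ... | inj₁ x~y = ⊥-elim (no-Z₁ u~x u~y x~y (~-sym v~u) (≁-sym v≁x) (≁-sym v≁y))
  ... | inj₂ x≁y =
    ⊥-elim (no-claw (≢-sym x≢v) (≢-sym y≢v) x≢y (~-sym v~u) u~x u~y v≁x v≁y x≁y)

  common-neighbour-sees-far : ∀ {v u w x} → v ~ w → u ~ v → u ~ w → u ~ x →
    NonNeighbour v x → w ~ x
  common-neighbour-sees-far v~w u~v u~w u~x (x≢v , v≁x) =
    proj₂ (P₃-centre-neighbour u~v u~x v≁x (≢-sym x≢v) u~w
      (≢-sym (~⇒≢ v~w)) (~-≁⇒≢ v~w v≁x))

  second-neighbour-unique : ∀ {v x y} → InTriangle v →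
    SecondNeighbour v x → SecondNeighbour v y → x ≡ y
  second-neighbour-unique {v} t (far-x , u , v~u , u~x) (far-y , u′ , v~u′ , u′~y)
    with u ≟F u′
  ... | yes refl = second-neighbour-unique-via v~u u~x u′~y far-x far-y
  ... | no u≢u′ with ~-or-≁ u u′
  ... | inj₁ u~u′ =
    second-neighbour-unique-via v~u′
      (common-neighbour-sees-far v~u′ (~-sym v~u) u~u′ u~x far-x) u′~y far-x far-y
  ... | inj₂ u≁u′ with third-neighbour t u≁u′
  ... | w , v~w , w≢u , w≢u′ =
    second-neighbour-unique-via v~w
      (common-neighbour-sees-far v~w (~-sym v~u) (~-sym w~u) u~x far-x)
      (common-neighbour-sees-far v~w (~-sym v~u′) (~-sym w~u′) u′~y far-y) far-x far-y
    where
    w~u×w~u′ : w ~ u × w ~ u′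
    w~u×w~u′ = P₃-centre-neighbour v~u v~u′ u≁u′ u≢u′ v~w w≢u w≢u′
    w~u = proj₁ w~u×w~u′
    w~u′ = proj₂ w~u×w~u′

  WithinTwo : Fin n → Fin n → Set
  WithinTwo v t = t ≡ v ⊎ v ~ t ⊎ SecondNeighbour v t

  within-two-step : (∀ t → InTriangle t) → ∀ {v t s} → WithinTwo v t → t ~ s → WithinTwo v s
  within-two-step _ (inj₁ refl) v~s = inj₂ (inj₁ v~s)
  within-two-step all-tri {v} {t} {s} t-near t~s with s ≟F v | ~-or-≁ v s
  ... | yes s≡v | _ = inj₁ s≡v
  ... | no _ | inj₁ v~s = inj₂ (inj₁ v~s)
  ... | no s≢v | inj₂ v≁s = inj₂ (inj₂ ((s≢v , v≁s) , witness t-near))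
    where
    witness : WithinTwo v t → Σ (Fin n) λ u → v ~ u × u ~ s
    witness (inj₁ refl)                  = ⊥-elim (~⇒¬≁ t~s v≁s)
    witness (inj₂ (inj₁ v~t))            = t , v~t , t~s
    witness (inj₂ (inj₂ ((t≢v , v≁t) , u , v~u , u~t))) with ~-or-≁ u s
    ... | inj₁ u~s = u , v~u , u~s
    ... | inj₂ u≁s with third-neighbour (all-tri t) u≁s
    ... | w , t~w , w≢u , w≢s = w , ~-sym w~v , proj₂ w~u×w~s
      where
      w~u×w~s : w ~ u × w ~ s
      w~u×w~s = P₃-centre-neighbour (~-sym u~t) t~s u≁s (~-≁⇒≢ v~u v≁s) t~w w≢u w≢s
      w~v : w ~ v
      w~v = proj₂ (P₃-centre-neighbour u~t (~-sym v~u) (≁-sym v≁t) t≢v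
        (~-sym (proj₁ w~u×w~s)) (≢-sym (~⇒≢ t~w)) (~-≁⇒≢ t~w (≁-sym v≁t)))

  within-two-reach : (∀ t → InTriangle t) → ∀ {P v a b} → ReachIn G P a b →
    WithinTwo v a → WithinTwo v b
  within-two-reach _       (here _)        near = near
  within-two-reach all-tri (step _ e rest) near = within-two-reach all-tri rest (within-two-step all-tri near e)

  at-most-one-nonneighbour : Connected G → HasTriangle → AtMostOneNonNeighbour
  at-most-one-nonneighbour conn (v₀ , t₀) {v} {x} {y} far-x far-y =
    second-neighbour-unique (all-tri v) (second far-x) (second far-y)
    where
    all-tri : ∀ t → InTriangle t
    all-tri t = triangle-reach (conn v₀ t) t₀
    second : ∀ {z} → NonNeighbour v z → SecondNeighbour v z
    second {z} far@(z≢v , v≁z) with within-two-reach all-tri (conn v z) (inj₁ refl)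
    ... | inj₁ z≡v        = ⊥-elim (z≢v z≡v)
    ... | inj₂ (inj₁ v~z) = ⊥-elim (~⇒¬≁ v~z v≁z)
    ... | inj₂ (inj₂ sn)  = sn

  triangle-free⇒max-degree-two : TriangleFree → MaxDegreeTwo
  triangle-free⇒max-degree-two no-tri {u} {x} {y} {z} u~x u~y u~z x≢y with z ≟F x | z ≟F y
  ... | yes z≡x | _       = inj₁ z≡x
  ... | no _    | yes z≡y = inj₂ z≡y
  ... | no z≢x  | no z≢y  =
    ⊥-elim (no-claw x≢y (≢-sym z≢x) (≢-sym z≢y) u~x u~y u~z
      (non-adjacent u~x u~y) (non-adjacent u~x u~z) (non-adjacent u~y u~z))
    where
    non-adjacent : ∀ {a b} → u ~ a → u ~ b → a ≁ b
    non-adjacent {a} {b} u~a u~b with ~-or-≁ a b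
    ... | inj₁ a~b = ⊥-elim (no-tri (u , a , b , u~a , u~b , a~b))
    ... | inj₂ a≁b = a≁b

module VertexSequences {n : ℕ} (G : Graph n) where

  open Adjacency G

  -- s 0, …, s (k - 1) for a length k carried alongside; later entries are ignored.
  Seq : Set
  Seq = ℕ → Fin n

  Fresh : ℕ → Seq → Fin n → Set
  Fresh k s w = ∀ i → i < k → s i ≢ w

  Distinct : ℕ → Seq → Set
  Distinct k s = ∀ i j → i < k → j < k → s i ≡ s j → i ≡ j

  Linked : ℕ → Seq → Set
  Linked k s = ∀ i → suc i < k → s i ~ s (suc i)

  IsPath : ℕ → Seq → Set
  IsPath k s = Distinct k s × Linked k s

  IsCycleSeq : ℕ → Seq → Set
  IsCycleSeq k s = 3 ≤ k × IsPath k s × s (pred k) ~ s 0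

  distinct⇒≢ : ∀ {k s} → Distinct k s → ∀ {i j} → i < k → j < k → i ≢ j → s i ≢ s j
  distinct⇒≢ distinct i<k j<k i≢j = i≢j ∘ distinct _ _ i<k j<k

  InImage : ℕ → Seq → Fin n → Set
  InImage k s v = Σ (Fin k) λ i → s (toℕ i) ≡ v

  image? : ∀ k s v → Dec (InImage k s v)
  image? k s v = any? λ i → s (toℕ i) ≟F v

  ∈-image : ∀ {k j v} s → j < k → s j ≡ v → InImage k s v
  ∈-image s j<k sj≡v = fromℕ< j<k , trans (cong s (toℕ-fromℕ< j<k)) sj≡v

  fresh-or-∈ : ∀ k s w → Fresh k s w ⊎ Σ ℕ λ j → j < k × s j ≡ w
  fresh-or-∈ k s w with image? k s w
  ... | yes (i , si≡w) = inj₂ (toℕ i , toℕ<n i , si≡w)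
  ... | no w∉           = inj₁ λ i i<k si≡w → w∉ (∈-image s i<k si≡w)

  covering⇒≤ : ∀ {k} s → (∀ v → InImage k s v) → n ≤ k
  covering⇒≤ s cover = injective⇒≤ {f = proj₁ ∘ cover} λ {x} {y} eq →
    trans (sym (proj₂ (cover x))) (trans (cong (s ∘ toℕ) eq) (proj₂ (cover y)))

  distinct⇒injective : ∀ {k s} → Distinct k s → Injective _≡_ _≡_ (s ∘ toℕ {k})
  distinct⇒injective distinct {i} {j} =
    toℕ-injective ∘ distinct (toℕ i) (toℕ j) (toℕ<n i) (toℕ<n j)

  distinct⇒≤ : ∀ {k s} → Distinct k s → k ≤ n
  distinct⇒≤ distinct = injective⇒≤ (distinct⇒injective distinct)

  fresh-vertex : ∀ {k} s → k < n → Σ (Fin n) (Fresh k s)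
  fresh-vertex {k} s k<n with all? (image? k s)
  ... | yes cover = ⊥-elim (<⇒≱ k<n (covering⇒≤ s cover))
  ... | no ¬cover with ¬∀⟶∃¬ n _ (image? k s) ¬cover
  ... | w , w∉ = w , λ i i<k si≡w → w∉ (∈-image s i<k si≡w)

  insert : Seq → ℕ → Fin n → Seq
  insert s p w i with <-cmp i p
  ... | tri< _ _ _ = s i
  ... | tri≈ _ _ _ = w
  ... | tri> _ _ _ = s (pred i)

  data Inserted (s : Seq) (p : ℕ) (w : Fin n) (i : ℕ) : Fin n → Set where
    before : i < p → Inserted s p w i (s i)
    at     : i ≡ p → Inserted s p w i w
    after  : p < i → Inserted s p w i (s (pred i))

  insert-view : ∀ s p w i → Inserted s p w i (insert s p w i)
  insert-view s p w i with <-cmp i p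
  ... | tri< i<p _ _ = before i<p
  ... | tri≈ _ i≡p _ = at i≡p
  ... | tri> _ _ p<i = after p<i

  insert-distinct : ∀ {L s p w} → p ≤ L → Distinct L s → Fresh L s w →
    Distinct (suc L) (insert s p w)
  insert-distinct {L} {s} {p} {w} p≤L distinct fresh i j i<1+L j<1+L
    with insert s p w i | insert-view s p w i | insert s p w j | insert-view s p w j
  ... | _ | before i<p | _ | before j<p = distinct i j (<-≤-trans i<p p≤L) (<-≤-trans j<p p≤L)
  ... | _ | before i<p | _ | at _      = ⊥-elim ∘ fresh i (<-≤-trans i<p p≤L)
  ... | _ | before i<p | _ | after p<j = λ si≡sj → ⊥-elim (<-irrefl
    (distinct i (pred j) (<-≤-trans i<p p≤L) (pred-< p<j j<1+L) si≡sj)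
    (<-≤-trans i<p (suc[m]≤n⇒m≤pred[n] p<j)))
  ... | _ | at _      | _ | before j<p = ⊥-elim ∘ fresh j (<-≤-trans j<p p≤L) ∘ sym
  ... | _ | at i≡p    | _ | at j≡p    = λ _ → trans i≡p (sym j≡p)
  ... | _ | at _      | _ | after p<j = ⊥-elim ∘ fresh (pred j) (pred-< p<j j<1+L) ∘ sym
  ... | _ | after p<i | _ | before j<p = λ si≡sj → ⊥-elim (<-irrefl
    (distinct j (pred i) (<-≤-trans j<p p≤L) (pred-< p<i i<1+L) (sym si≡sj))
    (<-≤-trans j<p (suc[m]≤n⇒m≤pred[n] p<i)))
  ... | _ | after p<i | _ | at _      = ⊥-elim ∘ fresh (pred i) (pred-< p<i i<1+L)
  ... | _ | after p<i | _ | after p<j =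
    pred-injective p<i p<j ∘ distinct (pred i) (pred j) (pred-< p<i i<1+L) (pred-< p<j j<1+L)

  insert-linked : ∀ {L s p w} → p ≤ L → Linked L s →
    (0 < p → s (pred p) ~ w) → (p < L → w ~ s p) → Linked (suc L) (insert s p w)
  insert-linked {L} {s} {p} {w} p≤L linked left right i 1+i<1+L
    with insert s p w i | insert-view s p w i | insert s p w (suc i) | insert-view s p w (suc i)
  ... | _ | before _   | _ | before 1+i<p = linked i (<-≤-trans 1+i<p p≤L)
  ... | _ | before _   | _ | at refl      = left (s≤s z≤n)
  ... | _ | before i<p | _ | after p<1+i  = ⊥-elim (<⇒≱ i<p (≤-pred p<1+i))
  ... | _ | at refl    | _ | before 1+p<p = ⊥-elim (<⇒≱ 1+p<p (n≤1+n p))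
  ... | _ | at refl    | _ | at 1+p≡p     = ⊥-elim (<-irrefl (sym 1+p≡p) (n<1+n p))
  ... | _ | at refl    | _ | after _      = right (≤-pred 1+i<1+L)
  ... | _ | after p<i  | _ | before 1+i<p = ⊥-elim (<-asym p<i (<-trans (n<1+n i) 1+i<p))
  ... | _ | after p<i  | _ | at 1+i≡p     = ⊥-elim (<-asym p<i (subst (i <_) 1+i≡p (n<1+n i)))
  ... | _ | after p<i  | _ | after _      = linked-pred (≤-trans (s≤s z≤n) p<i) (≤-pred 1+i<1+L)
    where
    linked-pred : ∀ {j} → 0 < j → j < L → s (pred j) ~ s j
    linked-pred {suc j} _ j<L = linked j j<L

  append-path : ∀ {k s w} → IsPath k s → Fresh k s w → (0 < k → s (pred k) ~ w) →
    IsPath (suc k) (insert s k w)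
  append-path (distinct , linked) fresh left =
    insert-distinct ≤-refl distinct fresh , insert-linked ≤-refl linked left (⊥-elim ∘ <-irrefl refl)

  insert-cycle : ∀ {L s p w} → IsCycleSeq L s → 0 < p → p < L → Fresh L s w →
    s (pred p) ~ w → w ~ s p → IsCycleSeq (suc L) (insert s p w)
  insert-cycle {L} {s} {p} {w} (3≤L , (distinct , linked) , closing) 0<p p<L fresh left right =
    ≤-trans 3≤L (n≤1+n L) ,
    (insert-distinct (<⇒≤ p<L) distinct fresh ,
     insert-linked (<⇒≤ p<L) linked (λ _ → left) (λ _ → right)) ,
    closing′
    where
    closing′ : insert s p w L ~ insert s p w 0
    closing′ with insert s p w L | insert-view s p w L | insert s p w 0 | insert-view s p w 0
    ... | _ | after _    | _ | before _ = closing
    ... | _ | before L<p | _ | _        = ⊥-elim (<-asym L<p p<L)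
    ... | _ | at refl    | _ | _        = ⊥-elim (<-irrefl refl p<L)
    ... | _ | after _    | _ | at refl  = ⊥-elim (<-irrefl refl 0<p)

  pair : Fin n → Fin n → Seq
  pair a b = insert (λ _ → a) 1 b

  pair-path : ∀ {a b} → a ~ b → IsPath 2 (pair a b)
  pair-path {a} a~b = append-path single fresh (λ _ → a~b)
    where
    single : IsPath 1 (λ _ → a)
    single = distinct , λ _ → λ { (s≤s ()) }
      where
      distinct : Distinct 1 (λ _ → a)
      distinct 0       0       _          _          _ = refl
      distinct (suc _) _       (s≤s ())   _          _
      distinct 0       (suc _) _          (s≤s ())   _
    fresh : Fresh 1 (λ _ → a) _
    fresh 0       _        = ~⇒≢ a~b
    fresh (suc _) (s≤s ())

  triple : Fin n → Fin n → Fin n → Seq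
  triple x y z = insert (pair x y) 2 z

  triangle-cycle : ∀ {x y z} → x ~ y → y ~ z → x ~ z → IsCycleSeq 3 (triple x y z)
  triangle-cycle x~y y~z x~z =
    s≤s (s≤s (s≤s z≤n)) , append-path (pair-path x~y) fresh (λ _ → y~z) , ~-sym x~z
    where
    fresh : Fresh 2 (pair _ _) _
    fresh 0 _ = ~⇒≢ x~z
    fresh 1 _ = ~⇒≢ y~z
    fresh (suc (suc _)) (s≤s (s≤s ()))

  cycle-edge : ∀ {L s} → IsCycleSeq L s → ∀ {i j} → j < L → Successor L i j → s i ~ s j
  cycle-edge (_ , (_ , linked) , _) j<L (inj₁ refl)         = linked _ j<L
  cycle-edge (_ , _ , closing)      _   (inj₂ (refl , refl)) = closing

  cycle-seq⇒IsCycle : ∀ {m s} → IsCycleSeq m s → IsCycle G m (s ∘ toℕ)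
  cycle-seq⇒IsCycle c@(3≤m , (distinct , _) , _) =
    3≤m , distinct⇒injective distinct , λ i j succ → cycle-edge c (toℕ<n j) succ

  chorded-cycle : ∀ {m s} → IsCycleSeq m s → (i j : Fin m) → ¬ Consecutive m i j →
    s (toℕ i) ~ s (toℕ j) → ChordedCycleOfLength G m
  chorded-cycle {s = s} c i j non-consecutive chord =
    s ∘ toℕ , cycle-seq⇒IsCycle c , i , j , (λ { refl → ~⇒≢ chord refl }) , non-consecutive , chord

module NearlyComplete {n : ℕ} (G : Graph n) (one-miss : Adjacency.AtMostOneNonNeighbour G) where

  open Adjacency G
  open VertexSequences G

  ~-all-but : ∀ {w x y} → NonNeighbour w x → y ≢ w → y ≢ x → w ~ y
  ~-all-but {w} {x} {y} far y≢w y≢x with ~-or-≁ w y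
  ... | inj₁ w~y = w~y
  ... | inj₂ w≁y = ⊥-elim (y≢x (sym (one-miss far (y≢w , w≁y))))

  fresh-sees-rest : ∀ {k s w} → Distinct k s → Fresh k s w →
    ∀ {q r} → q < k → r < k → q ≢ r → w ≁ s q → w ~ s r
  fresh-sees-rest distinct fresh q<k r<k q≢r w≁sq =
    ~-all-but (fresh _ q<k , w≁sq) (fresh _ r<k) (distinct⇒≢ distinct r<k q<k (q≢r ∘ sym))

  InsertionPoint : ℕ → Seq → Fin n → Set
  InsertionPoint L s w = Σ ℕ λ p → 0 < p × p < L × s (pred p) ~ w × w ~ s p

  fresh-insertion : ∀ {L s w} → IsCycleSeq L s → 4 ≤ L → Fresh L s w → InsertionPoint L s w
  fresh-insertion {L} {s} {w} (_ , (distinct , _) , _) 4≤L fresh =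
    choose (~-or-≁ w (s 0)) (~-or-≁ w (s 1))
    where
    sees : ∀ {q r} → q < 2 → 2 ≤ r → r < L → w ≁ s q → w ~ s r
    sees q<2 2≤r r<L =
      fresh-sees-rest distinct fresh (<-trans q<r r<L) r<L (<⇒≢ q<r)
      where q<r = <-≤-trans q<2 2≤r
    insert-at-3 : ∀ {q} → q < 2 → w ≁ s q → InsertionPoint L s w
    insert-at-3 q<2 w≁sq =
      3 , s≤s z≤n , 4≤L ,
      ~-sym (sees q<2 ≤-refl (≤-trans (n≤1+n 3) 4≤L) w≁sq) , sees q<2 (n≤1+n 2) 4≤L w≁sq
    choose : w ~ s 0 ⊎ w ≁ s 0 → w ~ s 1 ⊎ w ≁ s 1 → InsertionPoint L s w
    choose (inj₁ w~s0) (inj₁ w~s1) = 1 , s≤s z≤n , ≤-trans (s≤s (s≤s z≤n)) 4≤L , ~-sym w~s0 , w~s1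
    choose (inj₂ w≁s0) _           = insert-at-3 (s≤s z≤n) w≁s0
    choose (inj₁ _)    (inj₂ w≁s1) = insert-at-3 ≤-refl w≁s1

  grow : ∀ {L s} → IsCycleSeq L s → 4 ≤ L → L < n → Σ Seq (IsCycleSeq (suc L))
  grow {s = s} c 4≤L L<n =
    let w , fresh = fresh-vertex s L<n
        p , 0<p , p<L , left , right = fresh-insertion c 4≤L fresh
    in insert s p w , insert-cycle c 0<p p<L fresh left right

  base-cycle : HasTriangle → 4 ≤ n → Σ Seq λ s → IsCycleSeq 4 s × s 0 ~ s 2
  base-cycle (a , b , c , a~b , a~c , b~c) 4≤n = choose (~-or-≁ w a) (~-or-≁ w b)
    where
    w : Fin n
    w = proj₁ (fresh-vertex (triple a b c) 4≤n)
    fresh : Fresh 3 (triple a b c) w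
    fresh = proj₂ (fresh-vertex (triple a b c) 4≤n)
    insert-into-triangle : ∀ {x y z} → x ~ y → y ~ z → x ~ z → w ~ x → w ~ y → z ≢ w →
      Σ Seq λ s → IsCycleSeq 4 s × s 0 ~ s 2
    insert-into-triangle {x} {y} {z} x~y y~z x~z w~x w~y z≢w =
      insert (triple x y z) 1 w ,
      insert-cycle (triangle-cycle x~y y~z x~z) (s≤s z≤n) (s≤s (s≤s z≤n)) fresh′ (~-sym w~x) w~y ,
      x~y
      where
      fresh′ : Fresh 3 (triple x y z) w
      fresh′ 0 _ = ~⇒≢ (~-sym w~x)
      fresh′ 1 _ = ~⇒≢ (~-sym w~y)
      fresh′ 2 _ = z≢w
      fresh′ (suc (suc (suc _))) (s≤s (s≤s (s≤s ())))
    a≢w = fresh 0 (s≤s z≤n)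
    b≢w = fresh 1 (s≤s (s≤s z≤n))
    c≢w = fresh 2 ≤-refl
    choose : w ~ a ⊎ w ≁ a → w ~ b ⊎ w ≁ b → Σ Seq λ s → IsCycleSeq 4 s × s 0 ~ s 2
    choose (inj₁ w~a) (inj₁ w~b) = insert-into-triangle a~b b~c a~c w~a w~b c≢w
    choose (inj₂ w≁a) _          =
      insert-into-triangle b~c (~-sym a~c) (~-sym a~b) (~-all-but (a≢w , w≁a) b≢w (~⇒≢ (~-sym a~b)))
        (~-all-but (a≢w , w≁a) c≢w (~⇒≢ (~-sym a~c))) a≢w
    choose (inj₁ w~a) (inj₂ w≁b) =
      insert-into-triangle a~c (~-sym b~c) a~b w~a (~-all-but (b≢w , w≁b) c≢w (~⇒≢ (~-sym b~c))) b≢w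

  cycle-of-length : HasTriangle → ∀ k → 4 + k ≤ n → Σ Seq (IsCycleSeq (4 + k))
  cycle-of-length triangle zero    4≤n   = let s , c , _ = base-cycle triangle 4≤n in s , c
  cycle-of-length triangle (suc k) 5+k≤n =
    grow (proj₂ (cycle-of-length triangle k (≤-trans (n≤1+n _) 5+k≤n)))
      (s≤s (s≤s (s≤s (s≤s z≤n)))) 5+k≤n

  long-cycle-chorded : ∀ {k s} → IsCycleSeq (5 + k) s → ChordedCycleOfLength G (5 + k)
  long-cycle-chorded {s = s} c@(_ , (distinct , _) , _) with ~-or-≁ (s 0) (s 2)
  ... | inj₁ s₀~s₂ = chorded-cycle c f0 (fs (fs f0)) non-consecutive-0-2 s₀~s₂
  ... | inj₂ s₀≁s₂ = chorded-cycle c f0 (fs (fs (fs f0))) non-consecutive-0-3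
    (~-all-but (s₂≢s₀ , s₀≁s₂) s₃≢s₀ s₃≢s₂)
    where
    s₂≢s₀ : s 2 ≢ s 0
    s₂≢s₀ = distinct⇒≢ distinct {2} {0} (s≤s (s≤s (s≤s z≤n))) (s≤s z≤n) λ ()
    s₃≢s₀ : s 3 ≢ s 0
    s₃≢s₀ = distinct⇒≢ distinct {3} {0} (s≤s (s≤s (s≤s (s≤s z≤n)))) (s≤s z≤n) λ ()
    s₃≢s₂ : s 3 ≢ s 2
    s₃≢s₂ = distinct⇒≢ distinct {3} {2}
      (s≤s (s≤s (s≤s (s≤s z≤n)))) (s≤s (s≤s (s≤s z≤n))) λ ()

  chorded-pancyclic : HasTriangle → ChordedPancyclic G
  chorded-pancyclic triangle _ (s≤s (s≤s (s≤s (s≤s {n = zero} z≤n)))) 4≤n =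
    let s , c , s₀~s₂ = base-cycle triangle 4≤n
    in chorded-cycle c f0 (fs (fs f0)) non-consecutive-0-2 s₀~s₂
  chorded-pancyclic triangle _ (s≤s (s≤s (s≤s (s≤s {n = suc k} z≤n)))) 5+k≤n =
    long-cycle-chorded (proj₂ (cycle-of-length triangle (suc k) 5+k≤n))

module _ {n : ℕ} (G : Graph n) where

  open Adjacency G
  open VertexSequences G

  two-connected⇒no-degree-one : TwoConnected G → NoDegreeOne
  two-connected⇒no-degree-one (3≤n , _ , avoid) {u} {p} u~p =
    let v , fresh = fresh-vertex (pair u p) 3≤n
    in first-step (avoid p u v (~⇒≢ u~p) (≢-sym (fresh 1 ≤-refl))) (fresh 0 (s≤s z≤n))

module DegreeTwo {n : ℕ} (G : Graph n)
  (max-two : Adjacency.MaxDegreeTwo G) (no-leaf : Adjacency.NoDegreeOne G) where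

  open Adjacency G
  open VertexSequences G

  Cycle : Set
  Cycle = Σ ℕ λ L → Σ Seq (IsCycleSeq L)

  path-neighbour : ∀ {L s} → IsPath L s → ∀ {i m} → suc (suc i) < L → m < L →
    s (suc i) ~ s m → m ≡ i ⊎ m ≡ suc (suc i)
  path-neighbour (distinct , linked) {i} {m} 2+i<L m<L e =
    Sum.map (distinct m i m<L i<L) (distinct m (suc (suc i)) m<L 2+i<L)
      (max-two (~-sym (linked i 1+i<L)) (linked (suc i) 2+i<L) e
        (distinct⇒≢ distinct i<L 2+i<L (<⇒≢ (<-trans (n<1+n i) (n<1+n (suc i))))))
    where
    1+i<L = <-trans (n<1+n (suc i)) 2+i<L
    i<L   = <-trans (n<1+n i) 1+i<L

  close-path : ∀ {k s} → k ≢ 0 → IsPath (2 + k) s → s (suc k) ~ s 0 → Cycle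
  close-path {zero}  k≢0 = ⊥-elim (k≢0 refl)
  close-path {suc k} {s} _ path last~first = 3 + k , s , s≤s (s≤s (s≤s z≤n)) , path , last~first

  extend-or-close : ∀ k s → IsPath (2 + k) s → Cycle ⊎ Σ Seq (IsPath (3 + k))
  extend-or-close k s path@(distinct , linked) with no-leaf (~-sym (linked k ≤-refl))
  ... | w , last~w , w≢prev with fresh-or-∈ (2 + k) s w
  ... | inj₁ fresh = inj₂ (insert s (2 + k) w , append-path path fresh (λ _ → last~w))
  ... | inj₂ (j , j<2+k , refl) = inj₁ (revisit j j<2+k last~w w≢prev)
    where
    revisit : ∀ j → j < 2 + k → s (suc k) ~ s j → s j ≢ s k → Cycle
    revisit j j<2+k last~sj sj≢prev with j ≟ℕ suc k | j ≟ℕ k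
    ... | yes refl | _        = ⊥-elim (~⇒≢ last~sj refl)
    ... | no _     | yes refl = ⊥-elim (sj≢prev refl)
    revisit zero    _     last~s₀ _ | no _ | no 0≢k = close-path (≢-sym 0≢k) path last~s₀
    revisit (suc j) j<2+k last~sj _ | no j≢1+k | no j≢k =
      ⊥-elim ([ (λ 1+k≡j → <-irrefl (sym 1+k≡j) j<1+k)
              , (λ 1+k≡2+j → <-irrefl (sym 1+k≡2+j) (s≤s 1+j<k)) ]
        (path-neighbour path 2+j<2+k (n<1+n (suc k)) (~-sym last~sj)))
      where
      1+j<k = ≤∧≢⇒< (≤-pred (≤∧≢⇒< (≤-pred j<2+k) j≢1+k)) j≢k
      2+j<2+k = <-trans (s≤s 1+j<k) (n<1+n (suc k))
      j<1+k = <-trans (n<1+n j) (<-trans 1+j<k (n<1+n k))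

  path-or-cycle : ∀ {a b} → a ~ b → ∀ t → Cycle ⊎ Σ Seq (IsPath (2 + t))
  path-or-cycle a~b zero    = inj₂ (pair _ _ , pair-path a~b)
  path-or-cycle a~b (suc t) with path-or-cycle a~b t
  ... | inj₁ cycle      = inj₁ cycle
  ... | inj₂ (s , path) = extend-or-close t s path

  cycle-exists : ∀ {a b} → a ~ b → Cycle
  cycle-exists a~b with path-or-cycle a~b n
  ... | inj₁ cycle              = cycle
  ... | inj₂ (_ , distinct , _) = ⊥-elim (1+n≰n (≤-trans (n≤1+n (suc n)) (distinct⇒≤ distinct)))

  cycle-neighbour : ∀ {L s} → IsCycleSeq L s → ∀ {i v} → i < L → s i ~ v →
    Σ ℕ λ j → j < L × s j ≡ v × (Successor L i j ⊎ Successor L j i)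
  cycle-neighbour {L} {s} c@(3≤L , (distinct , _) , _) {i} i<L si~v
    with successor-index i i<L | predecessor-index i i<L
  ... | j₁ , j₁<L , i→j₁ | j₂ , j₂<L , j₂→i =
    [ (λ v≡sj₁ → j₁ , j₁<L , sym v≡sj₁ , inj₁ i→j₁)
    , (λ v≡sj₂ → j₂ , j₂<L , sym v≡sj₂ , inj₂ j₂→i) ]
      (max-two (cycle-edge c j₁<L i→j₁) (~-sym (cycle-edge c i<L j₂→i)) si~v
        (distinct⇒≢ distinct j₁<L j₂<L λ { refl → successor-asym 3≤L i→j₁ j₂→i }))

  reach-stays-on-cycle : ∀ {L s} → IsCycleSeq L s → ∀ {P a b} → ReachIn G P a b →
    InImage L s a → InImage L s b
  reach-stays-on-cycle c (here _)              a∈ = a∈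
  reach-stays-on-cycle {s = s} c (step _ si~w rest) (i , refl) =
    let j , j<L , sj≡w , _ = cycle-neighbour c (toℕ<n i) si~w
    in reach-stays-on-cycle c rest (∈-image s j<L sj≡w)

  hamiltonian-cycle⇒cycle-graph : ∀ {s} → IsCycleSeq n s → IsCycleGraph G
  hamiltonian-cycle⇒cycle-graph {s} c@(_ , (distinct , _) , _) =
    s ∘ toℕ , distinct⇒injective distinct , λ i j → mk⇔ (to i j) (from i j)
    where
    to : ∀ i j → Consecutive n i j → s (toℕ i) ~ s (toℕ j)
    to i j (inj₁ i→j) = cycle-edge c (toℕ<n j) i→j
    to i j (inj₂ j→i) = ~-sym (cycle-edge c (toℕ<n i) j→i)
    from : ∀ i j → s (toℕ i) ~ s (toℕ j) → Consecutive n i j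
    from i j e with cycle-neighbour c (toℕ<n i) e
    ... | j′ , j′<n , sj′≡sj , consecutive with distinct j′ (toℕ j) j′<n (toℕ<n j) sj′≡sj
    ... | refl = consecutive

  connected⇒cycle-graph : Connected G → 2 ≤ n → IsCycleGraph G
  connected⇒cycle-graph conn 2≤n =
    let v , w , v≢w = two-vertices 2≤n
        _ , v~u , _ = first-step (conn v w) v≢w
        L , s , c@(3≤L , (distinct , _) , _) = cycle-exists v~u
        covers : ∀ x → InImage L s x
        covers x = reach-stays-on-cycle c (conn (s 0) x) (∈-image s (≤-trans (s≤s z≤n) 3≤L) refl)
        L≡n = ≤-antisym (distinct⇒≤ distinct) (covering⇒≤ s covers)
    in hamiltonian-cycle⇒cycle-graph (subst (λ m → IsCycleSeq m s) L≡n c)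

module _ {n : ℕ} (G : Graph n) (claw-free : Free claw G) (Z₁-free : Free Z₁ G) where

  open Adjacency G
  open ClawZ₁Free G claw-free Z₁-free

  cycle-or-chorded-pancyclic : TwoConnected G → IsCycleGraph G ⊎ ChordedPancyclic G
  cycle-or-chorded-pancyclic two-connected@(3≤n , connected , _) with triangle?
  ... | yes triangle =
    inj₂ (NearlyComplete.chorded-pancyclic G (at-most-one-nonneighbour connected triangle) triangle)
  ... | no no-triangle =
    inj₁ (DegreeTwo.connected⇒cycle-graph G (triangle-free⇒max-degree-two no-triangle)
            (two-connected⇒no-degree-one G two-connected) connected (≤-trans (n≤1+n 2) 3≤n))

corollary1 : (n : ℕ) → (G : Graph n) → 10 ≤ n → TwoConnected G →
    Free claw G → Free Z₁ G → IsCycleGraph G ⊎ ChordedPancyclic G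
corollary1 n G _ two-connected claw-free Z₁-free =
  cycle-or-chorded-pancyclic G claw-free Z₁-free two-connected
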